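{- Let $S=\{1,\dots,n\}$ and $\mathbf{w}=(w_1,\dots,w_n)\in\mathbb{R}_{>0}^n$. The procedure Construct applied to $(S,\mathbf{w})$ outputs a proposal array $P$ for $(S,\mathbf{w})$ in time $O(n)$.
   Context: Computation model: randomized RAM, where arithmetic on integers and fixed-precision numbers, floor, ceiling, logarithms and biased coin flips take constant time. A proposal array for $(S,\mathbf{w})$ is a finite array whose entries are elements of $S$ in which every $i\in S$ occurs at least once; the number of occurrences of $i$ is its count $c_i$. Procedure Construct: compute $W=\sum_j w_j$ and the mean $\bar w=W/n$; starting from an empty array $P$, for each $i\in S$ append $i$ to $P$ exactly $\lceil w_i/\bar w\rceil$ times; return $P$.
   Formalization: The weight vector $\mathbf{w}$ has entries in the positive rationals rather than in $\mathbb{R}_{>0}$. -}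

module Defs where

open import Data.Nat as ℕ using (ℕ; zero; suc; _+_)
open import Data.Integer as ℤ using (ℤ; ∣_∣)
open import Data.Rational as ℚ using (ℚ; 0ℚ; _/_; ≢-nonZero; ceiling)
open import Data.Rational.Properties using (_≟_)
open import Data.Fin using (Fin)
open import Data.List using (List; []; _∷_; _++_; replicate; allFin)
open import Data.List.Membership.Propositional using (_∈_)
open import Data.Product using (_×_; _,_; proj₁; proj₂)
open import Relation.Nullary using (yes; no)

-- Proposal arrays.  S = {1,…,n} is represented by Fin n; an array with
-- entries in S is a List (Fin n).  P is a proposal array for (S,w) iff
-- every i ∈ S occurs in P at least once.

IsProposalArray : (n : ℕ) → List (Fin n) → Set
IsProposalArray n P = ∀ (i : Fin n) → i ∈ P

-- A costed computation returns its result together with the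
-- number of unit-cost RAM steps it performed.  Every arithmetic operation
-- on numbers (+, division, ceiling), every loop iteration and every
-- single-entry append to the array costs exactly one step.

Cost : Set → Set
Cost A = A × ℕ

result : {A : Set} → Cost A → A
result = proj₁

time : {A : Set} → Cost A → ℕ
time = proj₂

-- Division of (fixed-precision) numbers.  The divisor in Construct is
-- always positive; the 0 branch only makes the function total.
_÷₀_ : ℚ → ℚ → ℚ
p ÷₀ q with q ≟ 0ℚ
... | yes _  = 0ℚ
... | no q≢0 = ℚ._÷_ p q {{≢-nonZero q≢0}}

sumC : {n : ℕ} → (Fin n → ℚ) → List (Fin n) → Cost ℚ
sumC w []       = 0ℚ , 0
sumC w (j ∷ js) with sumC w js
... | (s , t) = (w j ℚ.+ s) , suc t

-- Main loop: for each i, compute ⌈w_i / w̄⌉ (one division, one ceiling,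
-- one loop-iteration step) and append i that many times (one step per
-- appended entry).
loopC : {n : ℕ} → (Fin n → ℚ) → ℚ → List (Fin n) → List (Fin n) → Cost (List (Fin n))
loopC w w̄ P []       = P , 0
loopC w w̄ P (i ∷ is) with loopC w w̄ (P ++ replicate k i) is
  where k = ∣ ceiling (w i ÷₀ w̄) ∣
... | (P′ , t) = P′ , (3 + ∣ ceiling (w i ÷₀ w̄) ∣ + t)

Construct : (n : ℕ) → (Fin n → ℚ) → Cost (List (Fin n))
Construct n w with sumC w (allFin n)
... | (W , t₁) with W ÷₀ (ℤ.+ n / 1)               -- w̄ = W / n : one step
...   | w̄ with loopC w w̄ [] (allFin n)
...     | (P , t₂) = P , (t₁ + 1 + t₂)

-- Since every w_i and the mean w̄ are positive, every count c_i = ⌈w_i/w̄⌉ is at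
-- least 1, so every i is appended.  Since ⌈x⌉ − 1 ≤ x, the counts satisfy
-- Σ_i (c_i − 1) ≤ Σ_i w_i/w̄ = n, so the array has at most 2n entries and the
-- n + 1 + Σ_i (3 + c_i) steps of Construct are at most 7n.
module Submission where

open import Defs
open import Data.Nat using (ℕ; NonZero; _≤_; _*_)
open import Data.Rational using (ℚ; Positive)
open import Data.Fin using (Fin)
import Data.Fin as Fin
open import Data.Product using (∃-syntax; _×_)

open import Data.Nat as ℕ using (zero; suc; _+_; _∸_; _<_; z≤n; s≤s)
import Data.Nat.Properties as ℕ
import Data.Nat.DivMod as ℕ
open import Data.Nat.Coprimality using (Coprime)
open import Data.Nat.Tactic.RingSolver using (solve-∀)
open import Data.Integer as ℤ using (+_; -[1+_]; +[1+_]; ∣_∣)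
import Data.Integer.Properties as ℤ
import Data.Integer.DivMod as ℤ
open import Data.Rational as ℚ using (mkℚ; 0ℚ; 1ℚ; 1/_; ceiling)
import Data.Rational.Properties as ℚ
open import Data.Rational.Literals using (fromℤ)
import Data.Rational.Unnormalised.Properties as ℚᵘ
open import Data.Rational.Unnormalised.Base using (*≡*)
open import Data.Product using (_,_; proj₁; proj₂)
open import Function using (id)
open import Data.List using (List; []; _∷_; _++_; replicate; allFin; length; tabulate)
open import Data.List.Properties using (length-tabulate)
open import Data.List.Membership.Propositional using (_∈_)
open import Data.List.Membership.Propositional.Properties using (∈-++⁺ˡ; ∈-++⁺ʳ; ∈-allFin)
open import Data.List.Relation.Unary.Any using (here; there)
open import Relation.Binary.PropositionalEquality
open import Relation.Nullary using (yes; no)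

fromℕ : ℕ → ℚ
fromℕ n = fromℤ (+ n)

fromℕ-+ : ∀ m n → fromℕ (m + n) ≡ fromℕ m ℚ.+ fromℕ n
fromℕ-+ m n =
  ℚ.toℚᵘ-injective (ℚᵘ.≃-sym (ℚᵘ.≃-trans (ℚ.toℚᵘ-homo-+ (fromℕ m) (fromℕ n)) (*≡* cross)))
  where
  cross : (+ m ℤ.* + 1 ℤ.+ + n ℤ.* + 1) ℤ.* + 1 ≡ + (m + n) ℤ.* + 1
  cross = begin
    (+ m ℤ.* + 1 ℤ.+ + n ℤ.* + 1) ℤ.* + 1 ≡⟨ ℤ.*-identityʳ _ ⟩
    + m ℤ.* + 1 ℤ.+ + n ℤ.* + 1           ≡⟨ cong₂ ℤ._+_ (ℤ.*-identityʳ (+ m)) (ℤ.*-identityʳ (+ n)) ⟩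
    + m ℤ.+ + n                           ≡⟨ ℤ.pos-+ m n ⟨
    + (m + n)                             ≡⟨ ℤ.*-identityʳ _ ⟨
    + (m + n) ℤ.* + 1                     ∎
    where open ≡-Reasoning

fromℕ-cancel-≤ : ∀ {m n} → fromℕ m ℚ.≤ fromℕ n → m ≤ n
fromℕ-cancel-≤ {m} {n} (ℚ.*≤* m≤n) rewrite ℤ.*-identityʳ (+ m) | ℤ.*-identityʳ (+ n) =
  ℤ.drop‿+≤+ m≤n

n/1≡fromℕ : ∀ n → + n ℚ./ 1 ≡ fromℕ n
n/1≡fromℕ n = ℚ.normalize-coprime _

n/1-positive : ∀ n .{{_ : NonZero n}} → Positive (+ n ℚ./ 1)
n/1-positive n@(suc _) = subst Positive (sym (n/1≡fromℕ n)) _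

-- ∣ -[1+ n ] /ℕ d ∣ is ⌈(1+n)/d⌉.
∣-[1+n]/ℕd∣-bounds : ∀ n d .{{_ : NonZero d}} → let k = ∣ -[1+ n ] ℤ./ℕ d ∣ in
                     0 < k × (k ∸ 1) * d ≤ suc n
∣-[1+n]/ℕd∣-bounds n d with suc n ℕ.% d in rem
... | suc _ = s≤s z≤n , ℕ.m/n*n≤m (suc n) d
... | zero rewrite ℤ.∣-i∣≡∣i∣ (+ (suc n ℕ./ d)) =
  quotient-pos , ℕ.≤-trans (ℕ.*-monoˡ-≤ d (ℕ.m∸n≤m (suc n ℕ./ d) 1)) (ℕ.m/n*n≤m (suc n) d)
  where
  quotient-pos : 0 < suc n ℕ./ d
  quotient-pos with suc n ℕ./ d in quot
  ... | suc _ = s≤s z≤n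
  ... | zero with () ← trans (ℕ.m≡m%n+[m/n]*n (suc n) d) (cong₂ (λ r q → r + q * d) rem quot)

∣ceiling∣≡∣-[1+n]/ℕd∣ : ∀ n d .(c : Coprime (suc n) (suc d)) →
                        ∣ ceiling (mkℚ +[1+ n ] d c) ∣ ≡ ∣ -[1+ n ] ℤ./ℕ suc d ∣
∣ceiling∣≡∣-[1+n]/ℕd∣ n d c =
  trans (ℤ.∣-i∣≡∣i∣ (-[1+ n ] ℤ./ + suc d)) (cong ∣_∣ (ℤ.div-pos-is-/ℕ -[1+ n ] (suc d)))

positive⇒0<∣ceiling∣ : ∀ q → Positive q → 0 < ∣ ceiling q ∣
positive⇒0<∣ceiling∣ (mkℚ +[1+ n ] d c) _
  rewrite ∣ceiling∣≡∣-[1+n]/ℕd∣ n d c = proj₁ (∣-[1+n]/ℕd∣-bounds n (suc d))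

positive⇒∣ceiling∣∸1≤ : ∀ q → Positive q → fromℕ (∣ ceiling q ∣ ∸ 1) ℚ.≤ q
positive⇒∣ceiling∣∸1≤ (mkℚ +[1+ n ] d c) _ = ℚ.*≤* cross
  where
  k = ∣ ceiling (mkℚ +[1+ n ] d c) ∣
  cross : + (k ∸ 1) ℤ.* + suc d ℤ.≤ +[1+ n ] ℤ.* + 1
  cross rewrite sym (ℤ.pos-* (k ∸ 1) (suc d))
              | ℤ.*-identityʳ +[1+ n ]
              | ∣ceiling∣≡∣-[1+n]/ℕd∣ n d c
    = ℤ.+≤+ (proj₂ (∣-[1+n]/ℕd∣-bounds n (suc d)))

÷₀≡÷ : ∀ p q .{{_ : ℚ.NonZero q}} → p ÷₀ q ≡ p ℚ.÷ q
÷₀≡÷ p q with q ℚ.≟ 0ℚ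
... | no _ = refl
÷₀≡÷ p q {{()}} | yes refl

÷₀-positive : ∀ p q → Positive p → Positive q → Positive (p ÷₀ q)
÷₀-positive p q p>0 q>0 =
  subst Positive (sym (÷₀≡÷ p q)) (ℚ.pos*pos⇒pos p {{p>0}} (1/ q) {{ℚ.1/pos⇒pos q}})
  where instance
  _ : Positive q
  _ = q>0
  _ : ℚ.NonZero q
  _ = ℚ.pos⇒nonZero q

0÷₀q≡0 : ∀ q → 0ℚ ÷₀ q ≡ 0ℚ
0÷₀q≡0 q with q ℚ.≟ 0ℚ
... | yes _ = refl
... | no q≢0 = ℚ.*-zeroˡ ((1/ q) {{ℚ.≢-nonZero q≢0}})

÷₀-distribʳ-+ : ∀ r p q → (p ℚ.+ q) ÷₀ r ≡ p ÷₀ r ℚ.+ q ÷₀ r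
÷₀-distribʳ-+ r p q with r ℚ.≟ 0ℚ
... | yes _ = refl
... | no _  = ℚ.*-distribʳ-+ _ p q

p÷₀q*q≡p : ∀ p q .{{_ : ℚ.NonZero q}} → (p ÷₀ q) ℚ.* q ≡ p
p÷₀q*q≡p p q = begin
  (p ÷₀ q) ℚ.* q     ≡⟨ cong (ℚ._* q) (÷₀≡÷ p q) ⟩
  p ℚ.* 1/ q ℚ.* q   ≡⟨ ℚ.*-assoc p (1/ q) q ⟩
  p ℚ.* (1/ q ℚ.* q) ≡⟨ cong (p ℚ.*_) (ℚ.*-inverseˡ q) ⟩
  p ℚ.* 1ℚ           ≡⟨ ℚ.*-identityʳ p ⟩
  p                  ∎
  where open ≡-Reasoning

p*q÷₀p≡q : ∀ p q .{{_ : ℚ.NonZero p}} → (p ℚ.* q) ÷₀ p ≡ q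
p*q÷₀p≡q p q = begin
  (p ℚ.* q) ÷₀ p     ≡⟨ ÷₀≡÷ (p ℚ.* q) p ⟩
  p ℚ.* q ℚ.* 1/ p   ≡⟨ cong (ℚ._* 1/ p) (ℚ.*-comm p q) ⟩
  q ℚ.* p ℚ.* 1/ p   ≡⟨ ℚ.*-assoc q p (1/ p) ⟩
  q ℚ.* (p ℚ.* 1/ p) ≡⟨ cong (q ℚ.*_) (ℚ.*-inverseʳ p) ⟩
  q ℚ.* 1ℚ           ≡⟨ ℚ.*-identityʳ q ⟩
  q                  ∎
  where open ≡-Reasoning

module _ {A : Set} where

  sumℚ : (A → ℚ) → List A → ℚ
  sumℚ f []       = 0ℚ
  sumℚ f (x ∷ xs) = f x ℚ.+ sumℚ f xs

  sumℕ : (A → ℕ) → List A → ℕ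
  sumℕ f []       = 0
  sumℕ f (x ∷ xs) = f x + sumℕ f xs

  sumℚ-positive : ∀ f → (∀ x → Positive (f x)) → ∀ x xs → Positive (sumℚ f (x ∷ xs))
  sumℚ-positive f f>0 x xs = ℚ.pos+nonNeg⇒pos (f x) {{f>0 x}} (sumℚ f xs) {{nonNeg xs}}
    where
    nonNeg : ∀ xs → ℚ.NonNegative (sumℚ f xs)
    nonNeg []       = _
    nonNeg (y ∷ ys) =
      ℚ.nonNeg+nonNeg⇒nonNeg (f y) {{ℚ.pos⇒nonNeg (f y) {{f>0 y}}}} (sumℚ f ys) {{nonNeg ys}}

  sumℚ-÷₀ : ∀ f q xs → sumℚ (λ x → f x ÷₀ q) xs ≡ sumℚ f xs ÷₀ q
  sumℚ-÷₀ f q []       = sym (0÷₀q≡0 q)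
  sumℚ-÷₀ f q (x ∷ xs) =
    trans (cong (f x ÷₀ q ℚ.+_) (sumℚ-÷₀ f q xs)) (sym (÷₀-distribʳ-+ q (f x) (sumℚ f xs)))

  fromℕ-sum-≤ : ∀ f g → (∀ x → fromℕ (f x) ℚ.≤ g x) → ∀ xs → fromℕ (sumℕ f xs) ℚ.≤ sumℚ g xs
  fromℕ-sum-≤ f g f≤g []       = ℚ.≤-refl
  fromℕ-sum-≤ f g f≤g (x ∷ xs) rewrite fromℕ-+ (f x) (sumℕ f xs) =
    ℚ.+-mono-≤ (f≤g x) (fromℕ-sum-≤ f g f≤g xs)

  sumℕ-mono-≤ : ∀ f g → (∀ x → f x ≤ g x) → ∀ xs → sumℕ f xs ≤ sumℕ g xs
  sumℕ-mono-≤ f g f≤g []       = z≤n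
  sumℕ-mono-≤ f g f≤g (x ∷ xs) = ℕ.+-mono-≤ (f≤g x) (sumℕ-mono-≤ f g f≤g xs)

  sumℕ-const+ : ∀ a f xs → sumℕ (λ x → a + f x) xs ≡ a * length xs + sumℕ f xs
  sumℕ-const+ a f []       = sym (trans (ℕ.+-identityʳ (a * 0)) (ℕ.*-zeroʳ a))
  sumℕ-const+ a f (x ∷ xs) rewrite sumℕ-const+ a f xs = regroup a (f x) (length xs) (sumℕ f xs)
    where
    regroup : ∀ a b l s → a + b + (a * l + s) ≡ a * suc l + (b + s)
    regroup = solve-∀

length-allFin : ∀ n → length (allFin n) ≡ n
length-allFin n = length-tabulate id

∈-replicate⁺ : ∀ {A : Set} {k} (x : A) → 0 < k → x ∈ replicate k x
∈-replicate⁺ x (s≤s _) = here refl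

sumC-≡ : ∀ {n} (w : Fin n → ℚ) is → sumC w is ≡ (sumℚ w is , length is)
sumC-≡ w []       = refl
sumC-≡ w (i ∷ is) rewrite sumC-≡ w is = refl

count : ∀ {n} → (Fin n → ℚ) → ℚ → Fin n → ℕ
count w w̄ i = ∣ ceiling (w i ÷₀ w̄) ∣

module _ {n} (w : Fin n → ℚ) (w̄ : ℚ) where

  loopC-time : ∀ P is → time (loopC w w̄ P is) ≡ sumℕ (λ i → 3 + count w w̄ i) is
  loopC-time P []       = refl
  loopC-time P (i ∷ is) with loopC w w̄ (P ++ replicate (count w w̄ i) i) is
                           | loopC-time (P ++ replicate (count w w̄ i) i) is
  ... | _ , t | refl = refl

  loopC-⊇ : ∀ P is {x} → x ∈ P → x ∈ result (loopC w w̄ P is)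
  loopC-⊇ P []       x∈P = x∈P
  loopC-⊇ P (i ∷ is) x∈P with loopC w w̄ (P ++ replicate (count w w̄ i) i) is
                            | loopC-⊇ (P ++ replicate (count w w̄ i) i) is (∈-++⁺ˡ x∈P)
  ... | _ | x∈P′ = x∈P′

  loopC-∈ : ∀ P is {x} → x ∈ is → 0 < count w w̄ x → x ∈ result (loopC w w̄ P is)
  loopC-∈ P (i ∷ is) (here refl) 0<c with loopC w w̄ (P ++ replicate (count w w̄ i) i) is
                                        | loopC-⊇ (P ++ replicate (count w w̄ i) i) is
                                                  (∈-++⁺ʳ P (∈-replicate⁺ i 0<c))
  ... | _ | x∈P′ = x∈P′
  loopC-∈ P (i ∷ is) (there x∈is) 0<c with loopC w w̄ (P ++ replicate (count w w̄ i) i) is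
                                         | loopC-∈ (P ++ replicate (count w w̄ i) i) is x∈is 0<c
  ... | _ | x∈P′ = x∈P′

mean : (n : ℕ) → (Fin n → ℚ) → ℚ
mean n w = sumℚ w (allFin n) ÷₀ (+ n ℚ./ 1)

Construct-≡ : ∀ n (w : Fin n → ℚ) → let loop = loopC w (mean n w) [] (allFin n) in
              Construct n w ≡ (result loop , n + 1 + time loop)
Construct-≡ n w rewrite sumC-≡ w (allFin n) | length-allFin n
  with loopC w (mean n w) [] (allFin n)
... | _ = refl

mean-positive : ∀ n .{{_ : NonZero n}} (w : Fin n → ℚ) → (∀ i → Positive (w i)) → Positive (mean n w)
mean-positive n@(suc _) w w>0 =
  ÷₀-positive (sumℚ w (allFin n)) (+ n ℚ./ 1) (sumℚ-positive w w>0 _ (tabulate Fin.suc)) (n/1-positive n)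

sum-÷₀-mean : ∀ n .{{_ : NonZero n}} (w : Fin n → ℚ) → (∀ i → Positive (w i)) →
              sumℚ (λ i → w i ÷₀ mean n w) (allFin n) ≡ fromℕ n
sum-÷₀-mean n w w>0 = begin
  sumℚ (λ i → w i ÷₀ w̄) (allFin n) ≡⟨ sumℚ-÷₀ w w̄ (allFin n) ⟩
  W ÷₀ w̄                           ≡⟨ cong (_÷₀ w̄) (p÷₀q*q≡p W N) ⟨
  (w̄ ℚ.* N) ÷₀ w̄                   ≡⟨ p*q÷₀p≡q w̄ N ⟩
  N                                ≡⟨ n/1≡fromℕ n ⟩
  fromℕ n                          ∎
  where
  open ≡-Reasoning
  W = sumℚ w (allFin n)
  N = + n ℚ./ 1
  w̄ = mean n w
  instance
    _ : ℚ.NonZero N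
    _ = ℚ.pos⇒nonZero N {{n/1-positive n}}
    _ : ℚ.NonZero w̄
    _ = ℚ.pos⇒nonZero w̄ {{mean-positive n w w>0}}

module _ (n : ℕ) .{{_ : NonZero n}} (w : Fin n → ℚ) (w>0 : ∀ i → Positive (w i)) where

  private
    w̄ = mean n w
    loop = loopC w w̄ [] (allFin n)
    c = count w w̄
    S = sumℕ (λ i → c i ∸ 1) (allFin n)

    ratio-positive : ∀ i → Positive (w i ÷₀ w̄)
    ratio-positive i = ÷₀-positive (w i) w̄ (w>0 i) (mean-positive n w w>0)

  count-positive : ∀ i → 0 < count w w̄ i
  count-positive i = positive⇒0<∣ceiling∣ (w i ÷₀ w̄) (ratio-positive i)

  sum-count∸1≤n : sumℕ (λ i → count w w̄ i ∸ 1) (allFin n) ≤ n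
  sum-count∸1≤n = fromℕ-cancel-≤ (subst (fromℕ S ℚ.≤_) (sum-÷₀-mean n w w>0)
    (fromℕ-sum-≤ _ _ (λ i → positive⇒∣ceiling∣∸1≤ (w i ÷₀ w̄) (ratio-positive i)) (allFin n)))

  Construct-isProposalArray : IsProposalArray n (result (Construct n w))
  Construct-isProposalArray i = subst (λ c → i ∈ result c) (sym (Construct-≡ n w))
    (loopC-∈ w w̄ [] (allFin n) (∈-allFin i) (count-positive i))

  Construct-time≤7n : time (Construct n w) ≤ 7 * n
  Construct-time≤7n = begin
    time (Construct n w)                          ≡⟨ cong time (Construct-≡ n w) ⟩
    n + 1 + time loop                             ≡⟨ cong (_+_ (n + 1)) (loopC-time w w̄ [] (allFin n)) ⟩
    n + 1 + sumℕ (λ i → 3 + c i) (allFin n)       ≤⟨ ℕ.+-monoʳ-≤ (n + 1) (sumℕ-mono-≤ _ _ step≤ (allFin n)) ⟩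
    n + 1 + sumℕ (λ i → 4 + (c i ∸ 1)) (allFin n) ≡⟨ cong (_+_ (n + 1)) (sumℕ-const+ 4 _ (allFin n)) ⟩
    n + 1 + (4 * length (allFin n) + S)           ≡⟨ cong (λ l → n + 1 + (4 * l + S)) (length-allFin n) ⟩
    n + 1 + (4 * n + S)                           ≤⟨ ℕ.+-mono-≤ 1+n≤2n (ℕ.+-monoʳ-≤ (4 * n) sum-count∸1≤n) ⟩
    n + n + (4 * n + n)                           ≡⟨ regroup n ⟩
    7 * n                                         ∎
    where
    open ℕ.≤-Reasoning
    step≤ : ∀ i → 3 + c i ≤ 4 + (c i ∸ 1)
    step≤ i = ℕ.+-monoʳ-≤ 3 (ℕ.m≤n+m∸n (c i) 1)
    1+n≤2n : n + 1 ≤ n + n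
    1+n≤2n = ℕ.+-monoʳ-≤ n (ℕ.>-nonZero⁻¹ n)
    regroup : ∀ n → n + n + (4 * n + n) ≡ 7 * n
    regroup = solve-∀

theorem3p2 : ∃[ c ] ((n : ℕ) → .{{_ : NonZero n}} → (w : Fin n → ℚ) → (∀ i → Positive (w i)) →
               IsProposalArray n (result (Construct n w)) × time (Construct n w) ≤ c * n)
theorem3p2 = 7 , λ n w w>0 → Construct-isProposalArray n w w>0 , Construct-time≤7n n w w>0
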